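{- Let $M$ be a sparse closed subgroup of a profinite group $F$. Then for each open subgroup $H$ of $F$ containing $M$ and for all $m,n\in\mathbb{N}$ there exists an open subgroup $K$ of $H$ containing $M$ with $(F:K)\ge m$ and such that $(K:L)\ge n$ for every proper open subgroup $L$ of $K$ containing $M$.
   Context: A closed subgroup $M$ of a profinite group $F$ is called sparse (in $F$) if for all $m,n\in\mathbb{N}$ there exists an open subgroup $K$ of $F$ containing $M$ such that $(F:K)\ge m$ and every proper open subgroup $L$ of $K$ containing $M$ satisfies $(K:L)\ge n$. -}

module Defs where

open import Level using (0ℓ)
open import Algebra.Bundles using (Group)
open import Data.Nat using (ℕ)
open import Data.Fin using (Fin)
open import Data.Unit using (⊤)
open import Data.Product using (Σ; _×_; _,_)
open import Data.Sum using (_⊎_)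
open import Data.Empty using (⊥)
open import Relation.Nullary using (¬_)
open import Relation.Binary.PropositionalEquality using (_≡_)
open import Relation.Unary using (Pred)

IsConnected : {X : Set} → (Pred X 0ℓ → Set) → Pred X 0ℓ → Set₁
IsConnected {X} IsOpen S =
  ¬ Σ (Pred X 0ℓ) (λ U → Σ (Pred X 0ℓ) (λ V →
      IsOpen U × IsOpen V ×
      (∀ x → S x → U x ⊎ V x) ×
      Σ X (λ x → S x × U x) ×
      Σ X (λ y → S y × V y) ×
      (∀ z → S z → U z → V z → ⊥)))

record ProfiniteGroup : Set₂ where
  field
    group : Group 0ℓ 0ℓ
  open Group group public
  Subset : Set₁
  Subset = Pred Carrier 0ℓ
  field
    IsOpen : Subset → Set
    open-resp : ∀ {U} → IsOpen U → ∀ {x y} → x ≈ y → U x → U y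
    open-univ : IsOpen (λ _ → ⊤)
    open-∩ : ∀ {U V} → IsOpen U → IsOpen V → IsOpen (λ x → U x × V x)
    open-⋃ : (I : Set) (U : I → Subset) → (∀ i → IsOpen (U i))
             → IsOpen (λ x → Σ I (λ i → U i x))
    -- multiplication continuous (as a map from the product space)
    mul-cont : ∀ {U} → IsOpen U → ∀ x y → U (x ∙ y)
               → Σ Subset (λ A → Σ Subset (λ B →
                   IsOpen A × IsOpen B × A x × B y ×
                   (∀ a b → A a → B b → U (a ∙ b))))
    inv-cont : ∀ {U} → IsOpen U → IsOpen (λ x → U (x ⁻¹))
    compact : (I : Set) (U : I → Subset) → (∀ i → IsOpen (U i))
              → (∀ x → Σ I (λ i → U i x))
              → Σ ℕ (λ k → Σ (Fin k → I) (λ f →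
                  ∀ x → Σ (Fin k) (λ j → U (f j) x)))
    hausdorff : ∀ x y → ¬ (x ≈ y)
                → Σ Subset (λ U → Σ Subset (λ V →
                    IsOpen U × IsOpen V × U x × V y × (∀ z → U z → V z → ⊥)))
    totally-disconnected : (S : Subset) → IsConnected IsOpen S
                           → ∀ x y → S x → S y → x ≈ y

  IsSubgroup : Subset → Set
  IsSubgroup S = (∀ {x y} → x ≈ y → S x → S y) × S ε
               × (∀ x y → S x → S y → S (x ∙ y)) × (∀ x → S x → S (x ⁻¹))

  IsOpenSubgroup : Subset → Set
  IsOpenSubgroup S = IsSubgroup S × IsOpen S

  IsClosedSubgroup : Subset → Set
  IsClosedSubgroup S = IsSubgroup S × IsOpen (λ x → ¬ S x)

  _⊆_ : Subset → Subset → Set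
  A ⊆ B = ∀ x → A x → B x

  whole : Subset
  whole _ = ⊤

  -- (A : B) ≥ m  (for B ⊆ A): A contains m elements lying in pairwise
  -- distinct left cosets of B.
  IndexAtLeast : Subset → Subset → ℕ → Set
  IndexAtLeast A B m = Σ (Fin m → Carrier) (λ f →
    (∀ i → A (f i)) × (∀ i j → ¬ (i ≡ j) → ¬ B ((f i) ⁻¹ ∙ f j)))

  Proper : Subset → Subset → Set
  Proper L K = L ⊆ K × Σ Carrier (λ x → K x × ¬ L x)

  Sparse : Subset → Set₁
  Sparse M = ∀ (m n : ℕ) → Σ Subset (λ K →
    IsOpenSubgroup K × M ⊆ K × IndexAtLeast whole K m ×
    (∀ L → IsOpenSubgroup L → M ⊆ L → Proper L K → IndexAtLeast K L n))

-- By compactness an open subgroup H has finitely many left cosets, say k.  By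
-- sparsity choose K with (F : K) ≥ m such that every proper open L ⊇ M of K has
-- (K : L) > k·n; then K ∩ H works.  Indeed, for L ⊇ M proper open in K ∩ H, take
-- k·n + 1 elements of K in distinct L-cosets; by pigeonhole n + 1 of them, g₀ … gₙ,
-- lie in one H-coset, and then the hᵢ = g₀⁻¹gᵢ lie in K ∩ H and in distinct
-- L-cosets, since hᵢ⁻¹hⱼ = gᵢ⁻¹gⱼ.
module Submission where

open import Defs
open import Algebra.Bundles using (Group)
import Algebra.Properties.Group as GroupProperties
open import Data.Nat using (ℕ; zero; suc; _+_; _*_; _≤_; _<_; _≟_; _<?_; s≤s⁻¹)
open import Data.Nat.Properties using (≤∧≢⇒<; ≮⇒≥; +-cancelˡ-<; +-monoˡ-≤; +-suc; <-≤-trans; n<1+n)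
open import Data.Fin as Fin using (Fin; toℕ; inject≤)
open import Data.Fin.Properties using (toℕ-injective; toℕ<n; toℕ-inject≤; suc-injective)
open import Data.List using (List; []; _∷_; length; filter; lookup; allFin)
open import Data.List.Properties using (length-tabulate)
open import Data.List.Membership.Propositional.Properties using (∈-lookup)
open import Data.List.Relation.Unary.All as All using (All; []; _∷_)
open import Data.List.Relation.Unary.All.Properties using (all-filter) renaming (filter⁺ to All-filter⁺)
open import Data.List.Relation.Unary.AllPairs using (_∷_)
open import Data.List.Relation.Unary.Unique.Propositional using (Unique)
open import Data.List.Relation.Unary.Unique.Propositional.Properties using (allFin⁺) renaming (filter⁺ to Unique-filter⁺)
open import Data.Product using (Σ; _×_; _,_; proj₁; proj₂; ∃-syntax; ∃₂)
open import Function using (_∘_; id)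
open import Function.Definitions using (Injective)
open import Relation.Nullary using (Dec; yes; no; ¬?; contradiction)
open import Relation.Unary using (_∩_)
open import Relation.Binary.PropositionalEquality as ≡ using (_≡_)

module _ {A : Set} {P : A → Set} (P? : ∀ x → Dec (P x)) where

  length-filter-split : ∀ xs → length (filter P? xs) + length (filter (¬? ∘ P?) xs) ≡ length xs
  length-filter-split [] = ≡.refl
  length-filter-split (x ∷ xs) with P? x
  ... | yes _ = ≡.cong suc (length-filter-split xs)
  ... | no _ = ≡.trans (+-suc _ _) (≡.cong suc (length-filter-split xs))

module _ {A : Set} (colour : A → ℕ) (s : ℕ) where

  hasColour : ∀ b x → Dec (colour x ≡ b)
  hasColour b x = colour x ≟ b

  monochromatic-pigeonhole : ∀ k {xs} → Unique xs → All (λ x → colour x < k) xs → k * s < length xs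
    → ∃₂ λ b ys → Unique ys × All (λ y → colour y ≡ b) ys × s < length ys
  monochromatic-pigeonhole zero {[]} _ _ ()
  monochromatic-pigeonhole zero {_ ∷ _} _ (() ∷ _) _
  monochromatic-pigeonhole (suc k) {xs} xs! xs<1+k 1+k*s<|xs|
    with s <? length (filter (hasColour k) xs)
  ... | yes s<|class| =
    k , filter (hasColour k) xs , Unique-filter⁺ (hasColour k) xs! , all-filter (hasColour k) xs , s<|class|
  ... | no s≮|class| = monochromatic-pigeonhole k (Unique-filter⁺ (¬? ∘ hasColour k) xs!) rest<k k*s<|rest|
    where
    rest<k : All (λ x → colour x < k) (filter (¬? ∘ hasColour k) xs)
    rest<k = All.zipWith (λ (<1+k , ≢k) → ≤∧≢⇒< (s≤s⁻¹ <1+k) ≢k)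
               (All-filter⁺ (¬? ∘ hasColour k) xs<1+k , all-filter (¬? ∘ hasColour k) xs)
    k*s<|rest| : k * s < length (filter (¬? ∘ hasColour k) xs)
    k*s<|rest| = +-cancelˡ-< s _ _ (<-≤-trans
      (≡.subst (s + k * s <_) (≡.sym (length-filter-split (hasColour k) xs)) 1+k*s<|xs|)
      (+-monoˡ-≤ _ (≮⇒≥ s≮|class|)))

Unique⇒lookup-injective : ∀ {A : Set} {xs : List A} → Unique xs → Injective _≡_ _≡_ (lookup xs)
Unique⇒lookup-injective (_ ∷ _) {Fin.zero} {Fin.zero} _ = ≡.refl
Unique⇒lookup-injective (x∉xs ∷ _) {Fin.zero} {Fin.suc j} x≡xsⱼ =
  contradiction x≡xsⱼ (All.lookup x∉xs (∈-lookup j))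
Unique⇒lookup-injective (x∉xs ∷ _) {Fin.suc i} {Fin.zero} xsᵢ≡x =
  contradiction (≡.sym xsᵢ≡x) (All.lookup x∉xs (∈-lookup i))
Unique⇒lookup-injective (_ ∷ xs!) {Fin.suc i} {Fin.suc j} xsᵢ≡xsⱼ =
  ≡.cong Fin.suc (Unique⇒lookup-injective xs! xsᵢ≡xsⱼ)

inject≤-injective : ∀ {m n} .(m≤n : m ≤ n) → Injective _≡_ _≡_ (λ i → inject≤ i m≤n)
inject≤-injective m≤n {i} {j} i≡j =
  toℕ-injective (≡.trans (≡.sym (toℕ-inject≤ i m≤n)) (≡.trans (≡.cong toℕ i≡j) (toℕ-inject≤ j m≤n)))

pigeonhole-fibre : ∀ {k N} s (f : Fin N → Fin k) → k * s < N
  → ∃₂ λ b (e : Fin (suc s) → Fin N) → Injective _≡_ _≡_ e × (∀ i → f (e i) ≡ b)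
pigeonhole-fibre {k} {N} s f k*s<N
  with b , ys , ys! , ys-colour , s<|ys| ← monochromatic-pigeonhole (toℕ ∘ f) s k (allFin⁺ N)
         (All.universal (toℕ<n ∘ f) (allFin N)) (≡.subst (k * s <_) (≡.sym (length-tabulate id)) k*s<N)
  = f (e Fin.zero) , e , inject≤-injective s<|ys| ∘ Unique⇒lookup-injective ys!
  , λ i → toℕ-injective (≡.trans (colour-e i) (≡.sym (colour-e Fin.zero)))
  where
  e : Fin (suc s) → Fin N
  e i = lookup ys (inject≤ i s<|ys|)
  colour-e : ∀ i → toℕ (f (e i)) ≡ b
  colour-e i = All.lookup ys-colour (∈-lookup (inject≤ i s<|ys|))

module _ {c ℓ} (G : Group c ℓ) where
  open Group G
  open GroupProperties G using (⁻¹-anti-homo-∙; \\-leftDividesʳ)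
  open import Relation.Binary.Reasoning.Setoid setoid

  quotient-left-invariant : ∀ x y z → (x ∙ y) ⁻¹ ∙ (x ∙ z) ≈ y ⁻¹ ∙ z
  quotient-left-invariant x y z = begin
    (x ∙ y) ⁻¹ ∙ (x ∙ z)     ≈⟨ ∙-congʳ (⁻¹-anti-homo-∙ x y) ⟩
    y ⁻¹ ∙ x ⁻¹ ∙ (x ∙ z)    ≈⟨ assoc (y ⁻¹) (x ⁻¹) (x ∙ z) ⟩
    y ⁻¹ ∙ (x ⁻¹ ∙ (x ∙ z))  ≈⟨ ∙-congˡ (\\-leftDividesʳ x z) ⟩
    y ⁻¹ ∙ z                 ∎

module _ (F : ProfiniteGroup) where
  open ProfiniteGroup F

  ∩-isSubgroup : ∀ {A B} → IsSubgroup A → IsSubgroup B → IsSubgroup (A ∩ B)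
  ∩-isSubgroup (A-resp , Aε , A-mul , A-inv) (B-resp , Bε , B-mul , B-inv) =
    (λ x≈y (x∈A , x∈B) → A-resp x≈y x∈A , B-resp x≈y x∈B) , (Aε , Bε)
    , (λ x y (x∈A , x∈B) (y∈A , y∈B) → A-mul x y x∈A y∈A , B-mul x y x∈B y∈B)
    , λ x (x∈A , x∈B) → A-inv x x∈A , B-inv x x∈B

  ∩-isOpenSubgroup : ∀ {A B} → IsOpenSubgroup A → IsOpenSubgroup B → IsOpenSubgroup (A ∩ B)
  ∩-isOpenSubgroup (A-sub , A-open) (B-sub , B-open) = ∩-isSubgroup A-sub B-sub , open-∩ A-open B-open

  CosetNeighbourhood : Subset → Carrier → Subset → Set
  CosetNeighbourhood H y V = IsOpen V × V y × (∀ x → V x → H (y ⁻¹ ∙ x))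

  CosetCover : Subset → ∀ {k} → (Fin k → Carrier) → Set
  CosetCover H t = ∀ x → ∃[ j ] H (t j ⁻¹ ∙ x)

  coset-neighbourhood : ∀ {H} → IsOpenSubgroup H → ∀ y → ∃[ V ] CosetNeighbourhood H y V
  coset-neighbourhood ((H-resp , Hε , _ , _) , H-open) y
    with _ , V , _ , V-open , y⁻¹∈U , y∈V , UV⊆H ← mul-cont H-open (y ⁻¹) y (H-resp (sym (inverseˡ y)) Hε)
    = V , V-open , y∈V , λ x x∈V → UV⊆H (y ⁻¹) x y⁻¹∈U x∈V

  openSubgroup-finiteCosetCover : ∀ {H} → IsOpenSubgroup H → ∃₂ λ k (t : Fin k → Carrier) → CosetCover H t
  openSubgroup-finiteCosetCover {H} H-open =
    let k , t , covered = compact Carrier V (proj₁ ∘ V-nbhd) (λ y → y , proj₁ (proj₂ (V-nbhd y)))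
    in  k , t , λ x → let j , x∈Vtⱼ = covered x in j , proj₂ (proj₂ (V-nbhd (t j))) x x∈Vtⱼ
    where
    V : Carrier → Subset
    V = proj₁ ∘ coset-neighbourhood H-open
    V-nbhd : ∀ y → CosetNeighbourhood H y (V y)
    V-nbhd = proj₂ ∘ coset-neighbourhood H-open

  IndexAtLeast-reindex : ∀ {A B m N} (e : Fin m → Fin N) → Injective _≡_ _≡_ e
    → IndexAtLeast A B N → IndexAtLeast A B m
  IndexAtLeast-reindex e e-injective (g , g∈A , g-separated) =
    g ∘ e , g∈A ∘ e , λ i j i≢j → g-separated (e i) (e j) (i≢j ∘ e-injective)

  IndexAtLeast-antitone : ∀ {A B B′ m} → B′ ⊆ B → IndexAtLeast A B m → IndexAtLeast A B′ m
  IndexAtLeast-antitone B′⊆B (g , g∈A , g-separated) = g , g∈A , λ i j i≢j → g-separated i j i≢j ∘ B′⊆B _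

  Proper-monoʳ : ∀ {L K K′} → K′ ⊆ K → Proper L K′ → Proper L K
  Proper-monoʳ K′⊆K (L⊆K′ , x , x∈K′ , x∉L) = (λ y → K′⊆K y ∘ L⊆K′ y) , x , K′⊆K x x∈K′ , x∉L

  sameCoset-quotient : ∀ {H p x y} → IsSubgroup H → H (p ⁻¹ ∙ x) → H (p ⁻¹ ∙ y) → H (x ⁻¹ ∙ y)
  sameCoset-quotient {p = p} {x} {y} (H-resp , _ , H-mul , H-inv) p⁻¹x∈H p⁻¹y∈H =
    H-resp (quotient-left-invariant group (p ⁻¹) x y) (H-mul _ _ (H-inv _ p⁻¹x∈H) p⁻¹y∈H)

  IndexAtLeast-∩-coset : ∀ {A H L m} p → IsSubgroup A → IsSubgroup H → IsSubgroup L
    → (w : IndexAtLeast A L (suc m)) → (∀ i → H (p ⁻¹ ∙ proj₁ w i)) → IndexAtLeast (A ∩ H) L (suc m)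
  IndexAtLeast-∩-coset p (_ , _ , A-mul , A-inv) H-sub (L-resp , _) (g , g∈A , g-separated) g∈pH =
    (λ i → g₀ ⁻¹ ∙ g i)
    , (λ i → A-mul _ _ (A-inv _ (g∈A Fin.zero)) (g∈A i) , sameCoset-quotient H-sub (g∈pH Fin.zero) (g∈pH i))
    , λ i j i≢j → g-separated i j i≢j ∘ L-resp (quotient-left-invariant group (g₀ ⁻¹) (g i) (g j))
    where
    g₀ : Carrier
    g₀ = g Fin.zero

  IndexAtLeast-∩-finiteIndex : ∀ {A H L k n} {t : Fin k → Carrier}
    → IsSubgroup A → IsSubgroup H → IsSubgroup L → CosetCover H t
    → IndexAtLeast A L (suc (k * n)) → IndexAtLeast (A ∩ H) L (suc n)
  IndexAtLeast-∩-finiteIndex {A} {H} {L} {n = n} {t} A-sub H-sub L-sub cover w@(g , _)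
    with b , e , e-injective , coset-e≡b ← pigeonhole-fibre n (proj₁ ∘ cover ∘ g) (n<1+n _)
    = IndexAtLeast-∩-coset {A} {H} {L} (t b) A-sub H-sub L-sub (IndexAtLeast-reindex {A} {L} e e-injective w)
        λ i → ≡.subst (λ j → H (t j ⁻¹ ∙ g (e i))) (coset-e≡b i) (proj₂ (cover (g (e i))))

open ProfiniteGroup

lemma2p2 : (F : ProfiniteGroup) (M : Subset F) → IsClosedSubgroup F M
    → Sparse F M
    → (H : Subset F) → IsOpenSubgroup F H → _⊆_ F M H
    → (m n : ℕ) → Σ (Subset F) (λ K →
        IsOpenSubgroup F K × _⊆_ F K H × _⊆_ F M K
        × IndexAtLeast F (whole F) K m
        × ((L : Subset F) → IsOpenSubgroup F L → _⊆_ F M L → Proper F L K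
           → IndexAtLeast F K L n))
lemma2p2 F M _ sparse H H-open@(H-sub , _) M⊆H m n
  with k , t , cover ← openSubgroup-finiteCosetCover F H-open
  with K , K-open@(K-sub , _) , M⊆K , [F:K]≥m , K-sparse ← sparse m (suc (k * n))
  = K ∩ H , ∩-isOpenSubgroup F K-open H-open , (λ _ → proj₂) , (λ x x∈M → M⊆K x x∈M , M⊆H x x∈M)
  , IndexAtLeast-antitone F {B = K} {K ∩ H} (λ _ → proj₁) [F:K]≥m
  , λ L L-open@(L-sub , _) M⊆L L<K∩H → IndexAtLeast-reindex F {K ∩ H} {L} Fin.suc suc-injective
      (IndexAtLeast-∩-finiteIndex F {K} {H} {L} K-sub H-sub L-sub cover
        (K-sparse L L-open M⊆L (Proper-monoʳ F (λ _ → proj₁) L<K∩H)))
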